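{- Consider a bipartite graph with $M$ left vertices, each of degree $c$, and $N$ right vertices, each of degree $d$. Choose a set of $k$ left vertices and a set of $\ell$ right vertices uniformly at random (among subsets of those sizes), and let $H$ be the subgraph they induce. Then $$\Pr[H\text{ contains an edge}]\ \ge\ \frac{ck\ell}{N}\left(1-\frac{c^2k^2}{N}-\frac{ck\ell}{N}\right).$$ -}

module Defs where

open import Data.Nat using (ℕ; zero; suc; _≡ᵇ_)
open import Data.Integer using (+_)
open import Data.Rational using (ℚ; 0ℚ; _/_)
open import Data.Bool using (Bool; true; false; _∧_)
open import Data.Fin using (Fin)
open import Data.Fin.Subset using (Subset; ∣_∣)
open import Data.Vec using ([]; _∷_; lookup; tabulate)
open import Data.List using (List; [_]; map; _++_; filterᵇ; length; cartesianProduct; allFin)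
open import Data.Bool.ListAction using (any)
open import Data.Product using (_×_; _,_)

BipGraph : ℕ → ℕ → Set
BipGraph M N = Fin M → Fin N → Bool

leftNbhd : ∀ {M N} → BipGraph M N → Fin M → Subset N
leftNbhd E i = tabulate (E i)

rightNbhd : ∀ {M N} → BipGraph M N → Fin N → Subset M
rightNbhd E j = tabulate (λ i → E i j)

subsets : ∀ n → List (Subset n)
subsets zero = [ [] ]
subsets (suc n) = map (true ∷_) (subsets n) ++ map (false ∷_) (subsets n)

subsetsOfSize : ∀ n → ℕ → List (Subset n)
subsetsOfSize n k = filterᵇ (λ S → ∣ S ∣ ≡ᵇ k) (subsets n)

inducedHasEdge : ∀ {M N} → BipGraph M N → Subset M → Subset N → Bool
inducedHasEdge {M} {N} E S T =
  any (λ i → any (λ j → lookup S i ∧ lookup T j ∧ E i j) (allFin N)) (allFin M)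

-- favourable / total, as a rational (0 if there are no outcomes at all).
ratio : ℕ → ℕ → ℚ
ratio a zero = 0ℚ
ratio a (suc t) = (+ a) / suc t

-- Pr[H contains an edge], where S is uniform among k-subsets of the left
-- vertices and T uniform among ℓ-subsets of the right vertices (independently),
-- i.e. uniform over pairs (S , T).
probEdge : ∀ {M N} → BipGraph M N → ℕ → ℕ → ℚ
probEdge {M} {N} E k ℓ =
  let pairs = cartesianProduct (subsetsOfSize M k) (subsetsOfSize N ℓ)
      good  = filterᵇ (λ { (S , T) → inducedHasEdge E S T }) pairs
  in ratio (length good) (length pairs)

module Submission where

-- Let X be the number of induced edges.  Pointwise 2·1[X > 0] ≥ 3X - X²
-- (second-order Bonferroni), so 2 Pr[X > 0] ≥ 2 E X - E[X² - X].  The moments of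
-- X only depend on how many of the random sets contain a given point or a given
-- pair of points, so we argue for 2-designs: families of k-sets in which each
-- point lies in r₁ and each pair of distinct points in r₂ ≤ r₁ members.  Double
-- counting gives n r₁ = k b and n² r₂ ≤ k² b, hence E X = ckℓ/N and
-- E[X² - X] ≤ 2 (ckℓ/N)(c²k² + ckℓ)/N, which rearranges to the claim.

open import Defs

open import Data.Bool using (Bool; true; false; _∧_)
open import Data.Bool.Properties using (T?)
open import Data.Bool.ListAction using (any)
open import Data.Fin using (Fin; zero; suc)
open import Data.Fin.Properties using (_≟_)
open import Data.Fin.Subset using (Subset; ∣_∣)
open import Data.List using (List; []; _∷_; _++_; map; length; filterᵇ; cartesianProduct; allFin)
open import Data.List.Properties using (map-tabulate; length-tabulate)
open import Data.List.Relation.Unary.All as All using (All; []; _∷_)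
open import Data.List.Relation.Unary.All.Properties using (all-filter)
open import Data.Nat using (ℕ; zero; suc; _+_; _*_; _≤_; _≡ᵇ_; z≤n; s≤s; NonZero; >-nonZero)
open import Data.Nat.Combinatorics using (_C_; nCk+nC[k+1]≡[n+1]C[k+1])
open import Data.Nat.Properties hiding (_≟_)
open import Data.Nat.Tactic.RingSolver using (solve-∀)
open import Data.Product using (_×_; _,_)
import Data.Vec as Vec
open import Data.Vec.Properties using (lookup∘tabulate)
open import Data.Vec using ([]; _∷_; lookup)
open import Function using (_∘_)
open import Relation.Binary.PropositionalEquality
open import Data.Empty using (⊥-elim)
open import Relation.Nullary using (does; yes; no)

⟦_⟧ : Bool → ℕ
⟦ true ⟧  = 1
⟦ false ⟧ = 0

⟦∧⟧ : ∀ a b → ⟦ a ∧ b ⟧ ≡ ⟦ a ⟧ * ⟦ b ⟧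
⟦∧⟧ true  b = sym (+-identityʳ ⟦ b ⟧)
⟦∧⟧ false b = refl

⟦⟧-idem : ∀ a → ⟦ a ⟧ * ⟦ a ⟧ ≡ ⟦ a ⟧
⟦⟧-idem true  = refl
⟦⟧-idem false = refl

module _ {a} {A : Set a} where

  ∑ : List A → (A → ℕ) → ℕ
  ∑ []       f = 0
  ∑ (x ∷ xs) f = f x + ∑ xs f

  syntax ∑ xs (λ x → e) = ∑[ x ← xs ] e

  ∑-cong : ∀ xs {f g : A → ℕ} → (∀ x → f x ≡ g x) → ∑ xs f ≡ ∑ xs g
  ∑-cong []       f≡g = refl
  ∑-cong (x ∷ xs) f≡g = cong₂ _+_ (f≡g x) (∑-cong xs f≡g)

  ∑-cong-All : ∀ {P : A → Set} {xs} {f g : A → ℕ} → (∀ {x} → P x → f x ≡ g x) → All P xs → ∑ xs f ≡ ∑ xs g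
  ∑-cong-All f≡g []         = refl
  ∑-cong-All f≡g (px ∷ pxs) = cong₂ _+_ (f≡g px) (∑-cong-All f≡g pxs)

  ∑-mono : ∀ xs {f g : A → ℕ} → (∀ x → f x ≤ g x) → ∑ xs f ≤ ∑ xs g
  ∑-mono []       f≤g = z≤n
  ∑-mono (x ∷ xs) f≤g = +-mono-≤ (f≤g x) (∑-mono xs f≤g)

  ∑-+ : ∀ xs (f g : A → ℕ) → ∑[ x ← xs ] (f x + g x) ≡ ∑ xs f + ∑ xs g
  ∑-+ []       f g = refl
  ∑-+ (x ∷ xs) f g = begin
    f x + g x + ∑[ y ← xs ] (f y + g y)  ≡⟨ cong (f x + g x +_) (∑-+ xs f g) ⟩
    f x + g x + (∑ xs f + ∑ xs g)         ≡⟨ +-exchange (f x) (g x) (∑ xs f) (∑ xs g) ⟩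
    f x + ∑ xs f + (g x + ∑ xs g)         ∎
    where
    open ≡-Reasoning
    +-exchange : ∀ p q r s → p + q + (r + s) ≡ p + r + (q + s)
    +-exchange = solve-∀

  ∑-*ˡ : ∀ xs m (f : A → ℕ) → ∑[ x ← xs ] (m * f x) ≡ m * ∑ xs f
  ∑-*ˡ []       m f = sym (*-zeroʳ m)
  ∑-*ˡ (x ∷ xs) m f = trans (cong (m * f x +_) (∑-*ˡ xs m f)) (sym (*-distribˡ-+ m (f x) (∑ xs f)))

  ∑-*ʳ : ∀ xs m (f : A → ℕ) → ∑[ x ← xs ] (f x * m) ≡ ∑ xs f * m
  ∑-*ʳ xs m f = trans (∑-cong xs (λ x → *-comm (f x) m)) (trans (∑-*ˡ xs m f) (*-comm m (∑ xs f)))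

  ∑-const : ∀ xs m → ∑[ _ ← xs ] m ≡ length xs * m
  ∑-const []       m = refl
  ∑-const (x ∷ xs) m = cong (m +_) (∑-const xs m)

  ∑-zero : ∀ xs → ∑[ _ ← xs ] 0 ≡ 0
  ∑-zero xs = trans (∑-const xs 0) (*-zeroʳ (length xs))

  ∑-++ : ∀ xs ys (f : A → ℕ) → ∑ (xs ++ ys) f ≡ ∑ xs f + ∑ ys f
  ∑-++ []       ys f = refl
  ∑-++ (x ∷ xs) ys f = trans (cong (f x +_) (∑-++ xs ys f)) (sym (+-assoc (f x) (∑ xs f) (∑ ys f)))

  length-filterᵇ : ∀ (p : A → Bool) xs → length (filterᵇ p xs) ≡ ∑[ x ← xs ] ⟦ p x ⟧
  length-filterᵇ p []       = refl
  length-filterᵇ p (x ∷ xs) with p x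
  ... | true  = cong suc (length-filterᵇ p xs)
  ... | false = length-filterᵇ p xs

  ∑-vanishes : ∀ (p : A → Bool) xs (f : A → ℕ) → (∀ x → p x ≡ false → f x ≡ 0) → any p xs ≡ false → ∑ xs f ≡ 0
  ∑-vanishes p []       f f≡0 _ = refl
  ∑-vanishes p (x ∷ xs) f f≡0 none with p x in px
  ... | false = cong₂ _+_ (f≡0 x px) (∑-vanishes p xs f f≡0 none)

∑-map : ∀ {a b} {A : Set a} {B : Set b} (g : A → B) xs (f : B → ℕ) → ∑ (map g xs) f ≡ ∑[ x ← xs ] f (g x)
∑-map g []       f = refl
∑-map g (x ∷ xs) f = cong (f (g x) +_) (∑-map g xs f)

∑-filterᵇ : ∀ {a} {A : Set a} (p : A → Bool) xs (f : A → ℕ) → ∑ (filterᵇ p xs) f ≡ ∑[ x ← xs ] (⟦ p x ⟧ * f x)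
∑-filterᵇ p []       f = refl
∑-filterᵇ p (x ∷ xs) f with p x
... | true  = cong₂ _+_ (sym (+-identityʳ (f x))) (∑-filterᵇ p xs f)
... | false = ∑-filterᵇ p xs f

length≡∑1 : ∀ {a} {A : Set a} (xs : List A) → length xs ≡ ∑[ _ ← xs ] 1
length≡∑1 xs = sym (trans (∑-const xs 1) (*-identityʳ (length xs)))

module _ {a b} {A : Set a} {B : Set b} where

  ∑-swap : ∀ (xs : List A) (ys : List B) (f : A → B → ℕ)
         → ∑[ x ← xs ] ∑[ y ← ys ] f x y ≡ ∑[ y ← ys ] ∑[ x ← xs ] f x y
  ∑-swap []       ys f = sym (∑-zero ys)
  ∑-swap (x ∷ xs) ys f = trans (cong (∑ ys (f x) +_) (∑-swap xs ys f))
                               (sym (∑-+ ys (f x) (λ y → ∑[ x′ ← xs ] f x′ y)))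

  ∑-product : ∀ (xs : List A) (ys : List B) (f : A → ℕ) (g : B → ℕ)
            → ∑ xs f * ∑ ys g ≡ ∑[ x ← xs ] ∑[ y ← ys ] (f x * g y)
  ∑-product xs ys f g = trans (sym (∑-*ʳ xs (∑ ys g) f))
                              (∑-cong xs (λ x → sym (∑-*ˡ ys (f x) g)))

  ∑-cartesianProduct : ∀ (xs : List A) (ys : List B) (f : A × B → ℕ)
                     → ∑ (cartesianProduct xs ys) f ≡ ∑[ x ← xs ] ∑[ y ← ys ] f (x , y)
  ∑-cartesianProduct []       ys f = refl
  ∑-cartesianProduct (x ∷ xs) ys f = trans (∑-++ (map (x ,_) ys) _ f)
    (cong₂ _+_ (∑-map (x ,_) ys f) (∑-cartesianProduct xs ys f))

length-cartesianProduct : ∀ {a b} {A : Set a} {B : Set b} (xs : List A) (ys : List B)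
                        → length (cartesianProduct xs ys) ≡ length xs * length ys
length-cartesianProduct xs ys = begin
  length (cartesianProduct xs ys)           ≡⟨ length≡∑1 (cartesianProduct xs ys) ⟩
  ∑[ _ ← cartesianProduct xs ys ] 1         ≡⟨ ∑-cartesianProduct xs ys (λ _ → 1) ⟩
  ∑[ _ ← xs ] ∑[ _ ← ys ] 1                 ≡⟨ ∑-cong xs (λ _ → length≡∑1 ys) ⟨
  ∑[ _ ← xs ] length ys                     ≡⟨ ∑-const xs (length ys) ⟩
  length xs * length ys                     ∎
  where open ≡-Reasoning

module _ {a b c d} {A : Set a} {B : Set b} {C : Set c} {D : Set d} where

  ∑∑-swap : ∀ (xs : List A) (ys : List B) (us : List C) (vs : List D) (f : A → B → C → D → ℕ)
          → ∑[ x ← xs ] ∑[ y ← ys ] ∑[ u ← us ] ∑[ v ← vs ] f x y u v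
          ≡ ∑[ u ← us ] ∑[ v ← vs ] ∑[ x ← xs ] ∑[ y ← ys ] f x y u v
  ∑∑-swap xs ys us vs f = begin
    ∑[ x ← xs ] ∑[ y ← ys ] ∑[ u ← us ] ∑[ v ← vs ] f x y u v
      ≡⟨ ∑-cong xs (λ x → ∑-swap ys us _) ⟩
    ∑[ x ← xs ] ∑[ u ← us ] ∑[ y ← ys ] ∑[ v ← vs ] f x y u v
      ≡⟨ ∑-cong xs (λ x → ∑-cong us (λ u → ∑-swap ys vs _)) ⟩
    ∑[ x ← xs ] ∑[ u ← us ] ∑[ v ← vs ] ∑[ y ← ys ] f x y u v
      ≡⟨ ∑-swap xs us _ ⟩
    ∑[ u ← us ] ∑[ x ← xs ] ∑[ v ← vs ] ∑[ y ← ys ] f x y u v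
      ≡⟨ ∑-cong us (λ u → ∑-swap xs vs _) ⟩
    ∑[ u ← us ] ∑[ v ← vs ] ∑[ x ← xs ] ∑[ y ← ys ] f x y u v ∎
    where open ≡-Reasoning

  ∑∑-*-∑∑ : ∀ (xs : List A) (ys : List B) (us : List C) (vs : List D) (f : A → B → ℕ) (g : C → D → ℕ)
          → (∑[ x ← xs ] ∑[ y ← ys ] f x y) * (∑[ u ← us ] ∑[ v ← vs ] g u v)
          ≡ ∑[ x ← xs ] ∑[ y ← ys ] ∑[ u ← us ] ∑[ v ← vs ] (f x y * g u v)
  ∑∑-*-∑∑ xs ys us vs f g = begin
    (∑[ x ← xs ] ∑[ y ← ys ] f x y) * G
      ≡⟨ ∑-*ʳ xs G _ ⟨
    ∑[ x ← xs ] ((∑[ y ← ys ] f x y) * G)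
      ≡⟨ ∑-cong xs (λ x → ∑-*ʳ ys G (f x)) ⟨
    ∑[ x ← xs ] ∑[ y ← ys ] (f x y * G)
      ≡⟨ ∑-cong xs (λ x → ∑-cong ys (λ y → ∑-*ˡ us (f x y) _)) ⟨
    ∑[ x ← xs ] ∑[ y ← ys ] ∑[ u ← us ] (f x y * ∑[ v ← vs ] g u v)
      ≡⟨ ∑-cong xs (λ x → ∑-cong ys (λ y → ∑-cong us (λ u → ∑-*ˡ vs (f x y) (g u))))  ⟨
    ∑[ x ← xs ] ∑[ y ← ys ] ∑[ u ← us ] ∑[ v ← vs ] (f x y * g u v) ∎
    where
    open ≡-Reasoning
    G : ℕ
    G = ∑[ u ← us ] ∑[ v ← vs ] g u v

module _ {a b} {A : Set a} {B : Set b} where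

  ∑∑-cong : ∀ (xs : List A) (ys : List B) {f g : A → B → ℕ} → (∀ x y → f x y ≡ g x y)
          → ∑[ x ← xs ] ∑[ y ← ys ] f x y ≡ ∑[ x ← xs ] ∑[ y ← ys ] g x y
  ∑∑-cong xs ys f≡g = ∑-cong xs (λ x → ∑-cong ys (f≡g x))

  ∑∑-mono : ∀ (xs : List A) (ys : List B) {f g : A → B → ℕ} → (∀ x y → f x y ≤ g x y)
          → ∑[ x ← xs ] ∑[ y ← ys ] f x y ≤ ∑[ x ← xs ] ∑[ y ← ys ] g x y
  ∑∑-mono xs ys f≤g = ∑-mono xs (λ x → ∑-mono ys (f≤g x))

  ∑∑-+ : ∀ (xs : List A) (ys : List B) (f g : A → B → ℕ)
       → ∑[ x ← xs ] ∑[ y ← ys ] (f x y + g x y) ≡ ∑[ x ← xs ] ∑[ y ← ys ] f x y + ∑[ x ← xs ] ∑[ y ← ys ] g x y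
  ∑∑-+ xs ys f g = trans (∑-cong xs (λ x → ∑-+ ys (f x) (g x))) (∑-+ xs _ _)

  ∑∑-*ˡ : ∀ (xs : List A) (ys : List B) m (f : A → B → ℕ)
        → ∑[ x ← xs ] ∑[ y ← ys ] (m * f x y) ≡ m * ∑[ x ← xs ] ∑[ y ← ys ] f x y
  ∑∑-*ˡ xs ys m f = trans (∑-cong xs (λ x → ∑-*ˡ ys m (f x))) (∑-*ˡ xs m _)

  ∑∑-factor : ∀ (xs : List A) (ys : List B) (f : A → ℕ) (g : B → ℕ) m
            → ∑[ x ← xs ] ∑[ y ← ys ] (f x * g y * m) ≡ ∑ xs f * ∑ ys g * m
  ∑∑-factor xs ys f g m = begin
    ∑[ x ← xs ] ∑[ y ← ys ] (f x * g y * m)  ≡⟨ ∑-cong xs (λ x → ∑-*ʳ ys m (λ y → f x * g y)) ⟩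
    ∑[ x ← xs ] (∑[ y ← ys ] (f x * g y) * m) ≡⟨ ∑-*ʳ xs m _ ⟩
    ∑[ x ← xs ] ∑[ y ← ys ] (f x * g y) * m   ≡⟨ cong (_* m) (∑-product xs ys f g) ⟨
    ∑ xs f * ∑ ys g * m                        ∎
    where open ≡-Reasoning

∑-allFin-suc : ∀ n (f : Fin (suc n) → ℕ) → ∑ (allFin (suc n)) f ≡ f zero + ∑[ i ← allFin n ] f (suc i)
∑-allFin-suc n f = cong (f zero +_)
  (trans (cong (λ is → ∑ is f) (sym (map-tabulate (λ i → i) suc))) (∑-map suc (allFin n) f))

δ : ∀ {n} → Fin n → Fin n → ℕ
δ i j = ⟦ does (i ≟ j) ⟧

∑-allFin-const : ∀ n m → ∑[ _ ← allFin n ] m ≡ n * m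
∑-allFin-const n m = trans (∑-const (allFin n) m) (cong (_* m) (length-tabulate {n = n} (λ i → i)))

∑-δ : ∀ n (i : Fin n) (f : Fin n → ℕ) → ∑[ j ← allFin n ] (δ i j * f j) ≡ f i
∑-δ (suc n) zero    f = begin
  ∑[ j ← allFin (suc n) ] (δ zero j * f j)  ≡⟨ ∑-allFin-suc n (λ j → δ zero j * f j) ⟩
  f zero + 0 + ∑[ _ ← allFin n ] 0          ≡⟨ cong₂ _+_ (+-identityʳ (f zero)) (∑-zero (allFin n)) ⟩
  f zero + 0                                ≡⟨ +-identityʳ (f zero) ⟩
  f zero                                    ∎
  where open ≡-Reasoning
∑-δ (suc n) (suc i) f = trans (∑-allFin-suc n (λ j → δ (suc i) j * f j)) (∑-δ n i (f ∘ suc))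

∑-δ-affine : ∀ n (i : Fin n) a b (f : Fin n → ℕ)
           → ∑[ j ← allFin n ] ((a + δ i j * b) * f j) ≡ a * ∑ (allFin n) f + b * f i
∑-δ-affine n i a b f = begin
  ∑[ j ← allFin n ] ((a + δ i j * b) * f j)
    ≡⟨ ∑-cong (allFin n) (λ j → expand a b (δ i j) (f j)) ⟩
  ∑[ j ← allFin n ] (a * f j + δ i j * (b * f j))
    ≡⟨ ∑-+ (allFin n) (λ j → a * f j) (λ j → δ i j * (b * f j)) ⟩
  ∑[ j ← allFin n ] (a * f j) + ∑[ j ← allFin n ] (δ i j * (b * f j))
    ≡⟨ cong₂ _+_ (∑-*ˡ (allFin n) a f) (∑-δ n i (λ j → b * f j)) ⟩
  a * ∑ (allFin n) f + b * f i ∎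
  where
  open ≡-Reasoning
  expand : ∀ a b d x → (a + d * b) * x ≡ a * x + d * (b * x)
  expand = solve-∀

χ : ∀ {n} → Subset n → Fin n → ℕ
χ S i = ⟦ lookup S i ⟧

∣∣≡∑χ : ∀ {n} (S : Subset n) → ∣ S ∣ ≡ ∑[ i ← allFin n ] χ S i
∣∣≡∑χ []                = refl
∣∣≡∑χ {suc n} (true ∷ S)  = trans (cong suc (∣∣≡∑χ S)) (sym (∑-allFin-suc n (χ (true ∷ S))))
∣∣≡∑χ {suc n} (false ∷ S) = trans (∣∣≡∑χ S) (sym (∑-allFin-suc n (χ (false ∷ S))))

∣tabulate∣ : ∀ {n} (f : Fin n → Bool) → ∣ Vec.tabulate f ∣ ≡ ∑[ j ← allFin n ] ⟦ f j ⟧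
∣tabulate∣ f = trans (∣∣≡∑χ (Vec.tabulate f)) (∑-cong (allFin _) (λ j → cong ⟦_⟧ (lookup∘tabulate f j)))

co : ∀ {n} → List (Subset n) → Fin n → Fin n → ℕ
co 𝒮 i i′ = ∑[ S ← 𝒮 ] (χ S i * χ S i′)

co-sym : ∀ {n} (𝒮 : List (Subset n)) i i′ → co 𝒮 i i′ ≡ co 𝒮 i′ i
co-sym 𝒮 i i′ = ∑-cong 𝒮 (λ S → *-comm (χ S i) (χ S i′))

record Is2Design {n} (𝒮 : List (Subset n)) (k r₁ r₂ : ℕ) : Set where
  field
    block-size  : All (λ S → ∣ S ∣ ≡ k) 𝒮
    replication : ∀ i → ∑[ S ← 𝒮 ] χ S i ≡ r₁
    index       : ∀ {i i′} → i ≢ i′ → co 𝒮 i i′ ≡ r₂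
    index≤replication : r₂ ≤ r₁

module Is2Design-Properties {n} {𝒮 : List (Subset n)} {k r₁ r₂ : ℕ} (D : Is2Design 𝒮 k r₁ r₂) where
  open Is2Design D

  co-diag : ∀ i → co 𝒮 i i ≡ r₁
  co-diag i = trans (∑-cong 𝒮 (λ S → ⟦⟧-idem (lookup S i))) (replication i)

  co-δ : ∀ i i′ → co 𝒮 i i′ + δ i i′ * r₂ ≡ r₂ + δ i i′ * r₁
  co-δ i i′ with i ≟ i′
  ... | yes refl = trans (cong (_+ 1 * r₂) (co-diag i)) (swap r₁ r₂)
    where
    swap : ∀ a b → a + 1 * b ≡ b + 1 * a
    swap = solve-∀
  ... | no i≢i′   = cong (_+ 0) (index i≢i′)

  co-bound : ∀ i i′ → co 𝒮 i i′ ≤ r₂ + δ i i′ * r₁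
  co-bound i i′ = ≤-trans (m≤m+n (co 𝒮 i i′) (δ i i′ * r₂)) (≤-reflexive (co-δ i i′))

  -- Counting incidences (point, block) in two ways: n r₁ = k b.
  replication-identity : n * r₁ ≡ k * length 𝒮
  replication-identity = begin
    n * r₁                                      ≡⟨ ∑-allFin-const n r₁ ⟨
    ∑[ i ← allFin n ] r₁                        ≡⟨ ∑-cong (allFin n) replication ⟨
    ∑[ i ← allFin n ] ∑[ S ← 𝒮 ] χ S i          ≡⟨ ∑-swap (allFin n) 𝒮 (λ i S → χ S i) ⟩
    ∑[ S ← 𝒮 ] ∑[ i ← allFin n ] χ S i          ≡⟨ ∑-cong-All (λ {S} ∣S∣≡k → trans (sym (∣∣≡∑χ S)) ∣S∣≡k) block-size ⟩
    ∑[ S ← 𝒮 ] k                                ≡⟨ ∑-const 𝒮 k ⟩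
    length 𝒮 * k                                ≡⟨ *-comm (length 𝒮) k ⟩
    k * length 𝒮                                ∎
    where open ≡-Reasoning

  -- Counting triples (i, i′, block) with i, i′ in the block: ∑ co = k² b.
  ∑∑co : ∑[ i ← allFin n ] ∑[ i′ ← allFin n ] co 𝒮 i i′ ≡ k * k * length 𝒮
  ∑∑co = begin
    ∑[ i ← allFin n ] ∑[ i′ ← allFin n ] co 𝒮 i i′
      ≡⟨ ∑-cong (allFin n) (λ i → ∑-swap (allFin n) 𝒮 _) ⟩
    ∑[ i ← allFin n ] ∑[ S ← 𝒮 ] ∑[ i′ ← allFin n ] (χ S i * χ S i′)
      ≡⟨ ∑-swap (allFin n) 𝒮 _ ⟩
    ∑[ S ← 𝒮 ] ∑[ i ← allFin n ] ∑[ i′ ← allFin n ] (χ S i * χ S i′)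
      ≡⟨ ∑-cong 𝒮 (λ S → ∑-product (allFin n) (allFin n) (χ S) (χ S)) ⟨
    ∑[ S ← 𝒮 ] (∑ (allFin n) (χ S) * ∑ (allFin n) (χ S))
      ≡⟨ ∑-cong-All (λ {S} ∣S∣≡k → cong (λ m → m * m) (trans (sym (∣∣≡∑χ S)) ∣S∣≡k)) block-size ⟩
    ∑[ S ← 𝒮 ] (k * k)
      ≡⟨ trans (∑-const 𝒮 (k * k)) (*-comm (length 𝒮) (k * k)) ⟩
    k * k * length 𝒮 ∎
    where open ≡-Reasoning

  row-identity : ∀ i → ∑[ i′ ← allFin n ] co 𝒮 i i′ + r₂ ≡ n * r₂ + r₁
  row-identity i = begin
    ∑[ i′ ← allFin n ] co 𝒮 i i′ + r₂
      ≡⟨ cong (∑[ i′ ← allFin n ] co 𝒮 i i′ +_) (∑-δ n i (λ _ → r₂)) ⟨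
    ∑[ i′ ← allFin n ] co 𝒮 i i′ + ∑[ i′ ← allFin n ] (δ i i′ * r₂)
      ≡⟨ ∑-+ (allFin n) (co 𝒮 i) (λ i′ → δ i i′ * r₂) ⟨
    ∑[ i′ ← allFin n ] (co 𝒮 i i′ + δ i i′ * r₂)
      ≡⟨ ∑-cong (allFin n) (co-δ i) ⟩
    ∑[ i′ ← allFin n ] (r₂ + δ i i′ * r₁)
      ≡⟨ ∑-+ (allFin n) (λ _ → r₂) (λ i′ → δ i i′ * r₁) ⟩
    ∑[ i′ ← allFin n ] r₂ + ∑[ i′ ← allFin n ] (δ i i′ * r₁)
      ≡⟨ cong₂ _+_ (∑-allFin-const n r₂) (∑-δ n i (λ _ → r₁)) ⟩
    n * r₂ + r₁ ∎
    where open ≡-Reasoning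

  -- The index bound n² r₂ ≤ k² b (from k² b + n r₂ = n² r₂ + n r₁ and r₂ ≤ r₁).
  index-bound : n * n * r₂ ≤ k * k * length 𝒮
  index-bound = +-cancelʳ-≤ (n * r₂) (n * n * r₂) (k * k * length 𝒮) (begin
      n * n * r₂ + n * r₂  ≤⟨ +-monoʳ-≤ (n * n * r₂) (*-monoʳ-≤ n index≤replication) ⟩
      n * n * r₂ + n * r₁  ≡⟨ distrib n r₂ r₁ ⟩
      n * (n * r₂ + r₁)    ≡⟨ ∑-allFin-const n (n * r₂ + r₁) ⟨
      ∑[ i ← allFin n ] (n * r₂ + r₁)
        ≡⟨ ∑-cong (allFin n) row-identity ⟨
      ∑[ i ← allFin n ] (∑[ i′ ← allFin n ] co 𝒮 i i′ + r₂)
        ≡⟨ ∑-+ (allFin n) _ (λ _ → r₂) ⟩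
      ∑[ i ← allFin n ] ∑[ i′ ← allFin n ] co 𝒮 i i′ + ∑[ i ← allFin n ] r₂
        ≡⟨ cong₂ _+_ ∑∑co (∑-allFin-const n r₂) ⟩
      k * k * length 𝒮 + n * r₂ ∎)
    where
    open ≤-Reasoning
    distrib : ∀ n a b → n * n * a + n * b ≡ n * (n * a + b)
    distrib = solve-∀

∑-subsets-suc : ∀ n (f : Subset (suc n) → ℕ)
              → ∑ (subsets (suc n)) f ≡ ∑[ S ← subsets n ] f (true ∷ S) + ∑[ S ← subsets n ] f (false ∷ S)
∑-subsets-suc n f = trans (∑-++ (map (true ∷_) (subsets n)) _ f)
  (cong₂ _+_ (∑-map (true ∷_) (subsets n) f) (∑-map (false ∷_) (subsets n) f))

∑-subsetsOfSize-suc : ∀ n k (f : Subset (suc n) → ℕ)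
  → ∑ (subsetsOfSize (suc n) (suc k)) f
  ≡ ∑[ S ← subsetsOfSize n k ] f (true ∷ S) + ∑[ S ← subsetsOfSize n (suc k) ] f (false ∷ S)
∑-subsetsOfSize-suc n k f = begin
  ∑ (subsetsOfSize (suc n) (suc k)) f
    ≡⟨ ∑-filterᵇ _ (subsets (suc n)) f ⟩
  ∑[ S ← subsets (suc n) ] (⟦ ∣ S ∣ ≡ᵇ suc k ⟧ * f S)
    ≡⟨ ∑-subsets-suc n _ ⟩
  ∑[ S ← subsets n ] (⟦ ∣ S ∣ ≡ᵇ k ⟧ * f (true ∷ S)) + ∑[ S ← subsets n ] (⟦ ∣ S ∣ ≡ᵇ suc k ⟧ * f (false ∷ S))
    ≡⟨ cong₂ _+_ (∑-filterᵇ _ (subsets n) _) (∑-filterᵇ _ (subsets n) _) ⟨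
  ∑[ S ← subsetsOfSize n k ] f (true ∷ S) + ∑[ S ← subsetsOfSize n (suc k) ] f (false ∷ S) ∎
  where open ≡-Reasoning

∑-subsetsOfSize-zero : ∀ n (f : Subset (suc n) → ℕ)
  → ∑ (subsetsOfSize (suc n) 0) f ≡ ∑[ S ← subsetsOfSize n 0 ] f (false ∷ S)
∑-subsetsOfSize-zero n f = begin
  ∑ (subsetsOfSize (suc n) 0) f
    ≡⟨ ∑-filterᵇ _ (subsets (suc n)) f ⟩
  ∑[ S ← subsets (suc n) ] (⟦ ∣ S ∣ ≡ᵇ 0 ⟧ * f S)
    ≡⟨ ∑-subsets-suc n _ ⟩
  ∑[ S ← subsets n ] 0 + ∑[ S ← subsets n ] (⟦ ∣ S ∣ ≡ᵇ 0 ⟧ * f (false ∷ S))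
    ≡⟨ cong₂ _+_ (∑-zero (subsets n)) (sym (∑-filterᵇ _ (subsets n) _)) ⟩
  0 + ∑[ S ← subsetsOfSize n 0 ] f (false ∷ S) ∎
  where open ≡-Reasoning

#subsetsOfSize : ∀ n k → length (subsetsOfSize n k) ≡ n C k
#subsetsOfSize zero    zero    = refl
#subsetsOfSize zero    (suc k) = refl
#subsetsOfSize (suc n) zero    = begin
  length (subsetsOfSize (suc n) 0)    ≡⟨ length≡∑1 (subsetsOfSize (suc n) 0) ⟩
  ∑[ _ ← subsetsOfSize (suc n) 0 ] 1  ≡⟨ ∑-subsetsOfSize-zero n (λ _ → 1) ⟩
  ∑[ _ ← subsetsOfSize n 0 ] 1        ≡⟨ length≡∑1 (subsetsOfSize n 0) ⟨
  length (subsetsOfSize n 0)          ≡⟨ #subsetsOfSize n 0 ⟩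
  1                                   ∎
  where open ≡-Reasoning
#subsetsOfSize (suc n) (suc k) = begin
  length (subsetsOfSize (suc n) (suc k))
    ≡⟨ length≡∑1 (subsetsOfSize (suc n) (suc k)) ⟩
  ∑[ _ ← subsetsOfSize (suc n) (suc k) ] 1
    ≡⟨ ∑-subsetsOfSize-suc n k (λ _ → 1) ⟩
  ∑[ _ ← subsetsOfSize n k ] 1 + ∑[ _ ← subsetsOfSize n (suc k) ] 1
    ≡⟨ cong₂ _+_ (length≡∑1 (subsetsOfSize n k)) (length≡∑1 (subsetsOfSize n (suc k))) ⟨
  length (subsetsOfSize n k) + length (subsetsOfSize n (suc k))
    ≡⟨ cong₂ _+_ (#subsetsOfSize n k) (#subsetsOfSize n (suc k)) ⟩
  n C k + n C suc k
    ≡⟨ nCk+nC[k+1]≡[n+1]C[k+1] n k ⟩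
  suc n C suc k ∎
  where open ≡-Reasoning

C-pos : ∀ {n k} → k ≤ n → 1 ≤ n C k
C-pos {n}     {zero}  _         = ≤-refl
C-pos {suc n} {suc k} (s≤s k≤n) =
  ≤-trans (C-pos k≤n) (≤-trans (m≤m+n (n C k) (n C suc k)) (≤-reflexive (nCk+nC[k+1]≡[n+1]C[k+1] n k)))

-- The number of k-subsets of Fin n containing a given point, resp. a given
-- pair of distinct points (the binomials (n-1 C k-1) and (n-2 C k-2)).
pointCount : ℕ → ℕ → ℕ
pointCount _       zero    = 0
pointCount zero    (suc k) = 0
pointCount (suc n) (suc k) = n C k

pairCount : ℕ → ℕ → ℕ
pairCount _       zero    = 0
pairCount zero    (suc k) = 0
pairCount (suc n) (suc k) = pointCount n k

pointCount-pascal : ∀ n k → pointCount (suc n) k + n C k ≡ suc n C k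
pointCount-pascal n zero    = refl
pointCount-pascal n (suc k) = nCk+nC[k+1]≡[n+1]C[k+1] n k

pairCount-pascal : ∀ n k → pairCount (suc (suc n)) k + pointCount (suc n) k ≡ pointCount (suc (suc n)) k
pairCount-pascal n zero    = refl
pairCount-pascal n (suc k) = pointCount-pascal n k

pointCount≤C : ∀ n k → pointCount n k ≤ n C k
pointCount≤C _       zero    = z≤n
pointCount≤C zero    (suc k) = z≤n
pointCount≤C (suc n) (suc k) =
  ≤-trans (m≤m+n (n C k) (n C suc k)) (≤-reflexive (nCk+nC[k+1]≡[n+1]C[k+1] n k))

pairCount≤pointCount : ∀ n k → pairCount n k ≤ pointCount n k
pairCount≤pointCount _       zero    = z≤n
pairCount≤pointCount zero    (suc k) = z≤n
pairCount≤pointCount (suc n) (suc k) = pointCount≤C n k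

point-count : ∀ n k (i : Fin n) → ∑[ S ← subsetsOfSize n k ] χ S i ≡ pointCount n k
point-count (suc n)       zero    zero    = trans (∑-subsetsOfSize-zero n _) (∑-zero (subsetsOfSize n 0))
point-count (suc n)       zero    (suc i) = trans (∑-subsetsOfSize-zero n _) (point-count n 0 i)
point-count (suc n)       (suc k) zero    = begin
  ∑[ S ← subsetsOfSize (suc n) (suc k) ] χ S zero
    ≡⟨ ∑-subsetsOfSize-suc n k (λ S → χ S zero) ⟩
  ∑[ _ ← subsetsOfSize n k ] 1 + ∑[ _ ← subsetsOfSize n (suc k) ] 0
    ≡⟨ cong₂ _+_ (sym (length≡∑1 (subsetsOfSize n k))) (∑-zero (subsetsOfSize n (suc k))) ⟩
  length (subsetsOfSize n k) + 0
    ≡⟨ trans (+-identityʳ _) (#subsetsOfSize n k) ⟩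
  n C k ∎
  where open ≡-Reasoning
point-count (suc (suc n)) (suc k) (suc i) = begin
  ∑[ S ← subsetsOfSize (suc (suc n)) (suc k) ] χ S (suc i)
    ≡⟨ ∑-subsetsOfSize-suc (suc n) k (λ S → χ S (suc i)) ⟩
  ∑[ S ← subsetsOfSize (suc n) k ] χ S i + ∑[ S ← subsetsOfSize (suc n) (suc k) ] χ S i
    ≡⟨ cong₂ _+_ (point-count (suc n) k i) (point-count (suc n) (suc k) i) ⟩
  pointCount (suc n) k + n C k
    ≡⟨ pointCount-pascal n k ⟩
  suc n C k ∎
  where open ≡-Reasoning

-- The pairs {0, i+1}: such a k-subset is {0} together with a (k-1)-subset through i.
pair-count-zero : ∀ n k (i : Fin n) → co (subsetsOfSize (suc n) k) zero (suc i) ≡ pairCount (suc n) k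
pair-count-zero n zero    i = trans (∑-subsetsOfSize-zero n _) (∑-zero (subsetsOfSize n 0))
pair-count-zero n (suc k) i = begin
  co (subsetsOfSize (suc n) (suc k)) zero (suc i)
    ≡⟨ ∑-subsetsOfSize-suc n k _ ⟩
  ∑[ S ← subsetsOfSize n k ] (χ S i + 0) + ∑[ _ ← subsetsOfSize n (suc k) ] 0
    ≡⟨ cong₂ _+_ (∑-cong (subsetsOfSize n k) (λ S → +-identityʳ (χ S i))) (∑-zero (subsetsOfSize n (suc k))) ⟩
  ∑[ S ← subsetsOfSize n k ] χ S i + 0
    ≡⟨ trans (+-identityʳ _) (point-count n k i) ⟩
  pointCount n k ∎
  where open ≡-Reasoning

pair-count : ∀ n k {i i′ : Fin n} → i ≢ i′ → co (subsetsOfSize n k) i i′ ≡ pairCount n k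
pair-count (suc n) k {zero}  {zero}   i≢i′ = ⊥-elim (i≢i′ refl)
pair-count (suc n) k {zero}  {suc i′} _    = pair-count-zero n k i′
pair-count (suc n) k {suc i} {zero}   _    =
  trans (co-sym (subsetsOfSize (suc n) k) (suc i) zero) (pair-count-zero n k i)
pair-count (suc n) zero {suc i} {suc i′} i≢i′ =
  trans (∑-subsetsOfSize-zero n _) (pair-count n 0 (i≢i′ ∘ cong suc))
pair-count (suc (suc zero)) (suc k) {suc zero} {suc zero} i≢i′ = ⊥-elim (i≢i′ refl)
pair-count (suc (suc (suc n))) (suc k) {suc i} {suc i′} i≢i′ = begin
  co (subsetsOfSize (suc (suc (suc n))) (suc k)) (suc i) (suc i′)
    ≡⟨ ∑-subsetsOfSize-suc (suc (suc n)) k _ ⟩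
  co (subsetsOfSize (suc (suc n)) k) i i′ + co (subsetsOfSize (suc (suc n)) (suc k)) i i′
    ≡⟨ cong₂ _+_ (pair-count _ k (i≢i′ ∘ cong suc)) (pair-count _ (suc k) (i≢i′ ∘ cong suc)) ⟩
  pairCount (suc (suc n)) k + pointCount (suc n) k
    ≡⟨ pairCount-pascal n k ⟩
  pointCount (suc (suc n)) k ∎
  where open ≡-Reasoning

subsetsOfSize-design : ∀ n k → Is2Design (subsetsOfSize n k) k (pointCount n k) (pairCount n k)
subsetsOfSize-design n k = record
  { block-size        = All.map (λ {S} → ≡ᵇ⇒≡ ∣ S ∣ k) (all-filter (T? ∘ λ S → ∣ S ∣ ≡ᵇ k) (subsets n))
  ; replication       = point-count n k
  ; index             = pair-count n k
  ; index≤replication = pairCount≤pointCount n k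
  }

x≤x*x : ∀ x → x ≤ x * x
x≤x*x zero    = z≤n
x≤x*x (suc x) = m≤m*n (suc x) (suc x)

-- The arithmetic turning the design and degree identities into the bounds of
-- the theorem; here a = ckℓ is N times the mean edge count and Q = b b′.
module ParameterBounds {M N c d k ℓ b b′ r₁ r₂ r₁′ r₂′ : ℕ}
  (rep : M * r₁ ≡ k * b) (rep′ : N * r₁′ ≡ ℓ * b′)
  (idx : M * M * r₂ ≤ k * k * b) (idx′ : N * N * r₂′ ≤ ℓ * ℓ * b′)
  (Mc≡Nd : M * c ≡ N * d) where

  a Q : ℕ
  a = c * k * ℓ
  Q = b * b′

  mean-scaled : r₁ * r₁′ * (M * c) * (N * N) ≡ a * N * Q
  mean-scaled = begin
    r₁ * r₁′ * (M * c) * (N * N)   ≡⟨ regroup r₁ r₁′ M c N ⟩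
    c * N * ((M * r₁) * (N * r₁′)) ≡⟨ cong₂ (λ x y → c * N * (x * y)) rep rep′ ⟩
    c * N * ((k * b) * (ℓ * b′))   ≡⟨ regroup′ c N k b ℓ b′ ⟩
    a * N * Q                      ∎
    where
    open ≡-Reasoning
    regroup : ∀ r r′ M c N → r * r′ * (M * c) * (N * N) ≡ c * N * ((M * r) * (N * r′))
    regroup = solve-∀
    regroup′ : ∀ c N k b ℓ b′ → c * N * ((k * b) * (ℓ * b′)) ≡ c * k * ℓ * N * (b * b′)
    regroup′ = solve-∀

  -- The three contributions of pairs of distinct edges: sharing no vertex,
  -- sharing the left vertex, and sharing the right vertex.
  disjoint-pairs : r₂ * (M * (r₂′ * c)) * (M * c) * (N * N) ≤ a * a * Q
  disjoint-pairs = begin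
    r₂ * (M * (r₂′ * c)) * (M * c) * (N * N) ≡⟨ regroup r₂ r₂′ M c N ⟩
    (M * M * r₂) * (N * N * r₂′) * (c * c)   ≤⟨ *-monoˡ-≤ (c * c) (*-mono-≤ idx idx′) ⟩
    (k * k * b) * (ℓ * ℓ * b′) * (c * c)     ≡⟨ regroup′ k b ℓ b′ c ⟩
    a * a * Q                                ∎
    where
    open ≤-Reasoning
    regroup : ∀ r r′ M c N → r * (M * (r′ * c)) * (M * c) * (N * N) ≡ (M * M * r) * (N * N * r′) * (c * c)
    regroup = solve-∀
    regroup′ : ∀ k b ℓ b′ c → (k * k * b) * (ℓ * ℓ * b′) * (c * c) ≡ c * k * ℓ * (c * k * ℓ) * (b * b′)
    regroup′ = solve-∀

  left-shared-pairs : r₂ * (r₁′ * d) * (M * c) * (N * N) ≤ a * (c * c * k * k) * Q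
  left-shared-pairs = begin
    r₂ * (r₁′ * d) * (M * c) * (N * N)   ≡⟨ regroup r₂ r₁′ d M c N ⟩
    r₂ * (N * r₁′) * (N * d) * (M * c)   ≡⟨ cong (λ z → r₂ * (N * r₁′) * z * (M * c)) Mc≡Nd ⟨
    r₂ * (N * r₁′) * (M * c) * (M * c)   ≡⟨ regroup′ r₂ N r₁′ M c ⟩
    (M * M * r₂) * (N * r₁′) * (c * c)   ≤⟨ *-monoˡ-≤ (c * c) (*-mono-≤ idx (≤-reflexive rep′)) ⟩
    (k * k * b) * (ℓ * b′) * (c * c)     ≡⟨ regroup″ k b ℓ b′ c ⟩
    (c * k) * (c * k) * (ℓ * Q)          ≤⟨ *-monoˡ-≤ (ℓ * Q) (*-monoʳ-≤ (c * k) (x≤x*x (c * k))) ⟩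
    (c * k) * ((c * k) * (c * k)) * (ℓ * Q) ≡⟨ regroup‴ c k ℓ Q ⟩
    a * (c * c * k * k) * Q              ∎
    where
    open ≤-Reasoning
    regroup : ∀ r r′ d M c N → r * (r′ * d) * (M * c) * (N * N) ≡ r * (N * r′) * (N * d) * (M * c)
    regroup = solve-∀
    regroup′ : ∀ r N r′ M c → r * (N * r′) * (M * c) * (M * c) ≡ (M * M * r) * (N * r′) * (c * c)
    regroup′ = solve-∀
    regroup″ : ∀ k b ℓ b′ c → (k * k * b) * (ℓ * b′) * (c * c) ≡ (c * k) * (c * k) * (ℓ * (b * b′))
    regroup″ = solve-∀
    regroup‴ : ∀ c k ℓ Q → (c * k) * ((c * k) * (c * k)) * (ℓ * Q) ≡ c * k * ℓ * (c * c * k * k) * Q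
    regroup‴ = solve-∀

  right-shared-pairs : r₁ * (r₂′ * c) * (M * c) * (N * N) ≤ a * a * Q
  right-shared-pairs = begin
    r₁ * (r₂′ * c) * (M * c) * (N * N)   ≡⟨ regroup r₁ r₂′ c M N ⟩
    (M * r₁) * (N * N * r₂′) * (c * c)   ≤⟨ *-monoˡ-≤ (c * c) (*-mono-≤ (≤-reflexive rep) idx′) ⟩
    (k * b) * (ℓ * ℓ * b′) * (c * c)     ≡⟨ regroup′ k b ℓ b′ c ⟩
    k * (c * c * ℓ * ℓ * Q)              ≤⟨ *-monoˡ-≤ (c * c * ℓ * ℓ * Q) (x≤x*x k) ⟩
    k * k * (c * c * ℓ * ℓ * Q)          ≡⟨ regroup″ k c ℓ Q ⟩
    a * a * Q                            ∎
    where
    open ≤-Reasoning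
    regroup : ∀ r r′ c M N → r * (r′ * c) * (M * c) * (N * N) ≡ (M * r) * (N * N * r′) * (c * c)
    regroup = solve-∀
    regroup′ : ∀ k b ℓ b′ c → (k * b) * (ℓ * ℓ * b′) * (c * c) ≡ k * (c * c * ℓ * ℓ * (b * b′))
    regroup′ = solve-∀
    regroup″ : ∀ k c ℓ Q → k * k * (c * c * ℓ * ℓ * Q) ≡ c * k * ℓ * (c * k * ℓ) * Q
    regroup″ = solve-∀

  correction-bound : (r₂ * (M * (r₂′ * c) + r₁′ * d) + r₁ * (r₂′ * c)) * (M * c) * (N * N)
                   ≤ 2 * ((a * (c * c * k * k) + a * a) * Q)
  correction-bound = begin
    (r₂ * (M * (r₂′ * c) + r₁′ * d) + r₁ * (r₂′ * c)) * (M * c) * (N * N)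
      ≡⟨ split r₂ (M * (r₂′ * c)) (r₁′ * d) (r₁ * (r₂′ * c)) (M * c) (N * N) ⟩
    r₂ * (M * (r₂′ * c)) * (M * c) * (N * N) + r₂ * (r₁′ * d) * (M * c) * (N * N)
      + r₁ * (r₂′ * c) * (M * c) * (N * N)
      ≤⟨ +-mono-≤ (+-mono-≤ disjoint-pairs left-shared-pairs) right-shared-pairs ⟩
    a * a * Q + a * (c * c * k * k) * Q + a * a * Q
      ≤⟨ m≤m+n _ (a * (c * c * k * k) * Q) ⟩
    a * a * Q + a * (c * c * k * k) * Q + a * a * Q + a * (c * c * k * k) * Q
      ≡⟨ collect a (c * c * k * k) Q ⟩
    2 * ((a * (c * c * k * k) + a * a) * Q) ∎
    where
    open ≤-Reasoning
    split : ∀ r x y z E n → (r * (x + y) + z) * E * n ≡ r * x * E * n + r * y * E * n + z * E * n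
    split = solve-∀
    collect : ∀ a β Q → a * a * Q + a * β * Q + a * a * Q + a * β * Q ≡ 2 * ((a * β + a * a) * Q)
    collect = solve-∀

-- For naturals, 3x ≤ 2 + x² (equality at x = 1, 2): the integer form of
-- the second-order Bonferroni bound 1[x > 0] ≥ x - x(x-1)/2.
3x≤2+x² : ∀ x → 3 * x ≤ 2 + x * x
3x≤2+x² zero          = z≤n
3x≤2+x² (suc zero)    = ≤-refl
3x≤2+x² (suc (suc y)) = ≤-trans (m≤m+n (3 * (2 + y)) (y * y + y)) (≤-reflexive (expand y))
  where
  expand : ∀ y → 3 * (2 + y) + (y * y + y) ≡ 2 + (2 + y) * (2 + y)
  expand = solve-∀

module InducedEdges {M N} (E : BipGraph M N) where

  e : Fin M → Fin N → ℕ
  e i j = ⟦ E i j ⟧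

  X : Subset M → Subset N → ℕ
  X S T = ∑[ i ← allFin M ] ∑[ j ← allFin N ] (χ S i * χ T j * e i j)

  #E : ℕ
  #E = ∑[ i ← allFin M ] ∑[ j ← allFin N ] e i j

  X≡0 : ∀ S T → inducedHasEdge E S T ≡ false → X S T ≡ 0
  X≡0 S T no-edge = ∑-vanishes _ (allFin M) _
    (λ i no-edge-at-i → ∑-vanishes _ (allFin N) _
      (λ j no-edge-at-ij → trans (edge-term i j) (cong ⟦_⟧ no-edge-at-ij)) no-edge-at-i)
    no-edge
    where
    edge-term : ∀ i j → χ S i * χ T j * e i j ≡ ⟦ lookup S i ∧ lookup T j ∧ E i j ⟧
    edge-term i j = trans (*-assoc (χ S i) (χ T j) (e i j))
      (sym (trans (⟦∧⟧ (lookup S i) _) (cong (χ S i *_) (⟦∧⟧ (lookup T j) (E i j)))))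

  bonferroni : ∀ S T → 3 * X S T ≤ 2 * ⟦ inducedHasEdge E S T ⟧ + X S T * X S T
  bonferroni S T with inducedHasEdge E S T in has-edge
  ... | true  = 3x≤2+x² (X S T)
  ... | false rewrite X≡0 S T has-edge = z≤n

  module _ (𝒮 : List (Subset M)) (𝒯 : List (Subset N)) where

    first-moment-formula : ∑[ S ← 𝒮 ] ∑[ T ← 𝒯 ] X S T
      ≡ ∑[ i ← allFin M ] ∑[ j ← allFin N ] (∑[ S ← 𝒮 ] χ S i * ∑[ T ← 𝒯 ] χ T j * e i j)
    first-moment-formula = trans (∑∑-swap 𝒮 𝒯 (allFin M) (allFin N) _)
      (∑∑-cong (allFin M) (allFin N) (λ i j → ∑∑-factor 𝒮 𝒯 (λ S → χ S i) (λ T → χ T j) (e i j)))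

    second-moment-formula : ∑[ S ← 𝒮 ] ∑[ T ← 𝒯 ] (X S T * X S T)
      ≡ ∑[ i ← allFin M ] ∑[ j ← allFin N ] ∑[ i′ ← allFin M ] ∑[ j′ ← allFin N ]
          (co 𝒮 i i′ * co 𝒯 j j′ * (e i j * e i′ j′))
    second-moment-formula = begin
      ∑[ S ← 𝒮 ] ∑[ T ← 𝒯 ] (X S T * X S T)
        ≡⟨ ∑∑-cong 𝒮 𝒯 (λ S T → ∑∑-*-∑∑ (allFin M) (allFin N) (allFin M) (allFin N) _ _) ⟩
      ∑[ S ← 𝒮 ] ∑[ T ← 𝒯 ] ∑[ i ← allFin M ] ∑[ j ← allFin N ] ∑[ i′ ← allFin M ] ∑[ j′ ← allFin N ] t S T i j i′ j′
        ≡⟨ ∑∑-swap 𝒮 𝒯 (allFin M) (allFin N) _ ⟩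
      ∑[ i ← allFin M ] ∑[ j ← allFin N ] ∑[ S ← 𝒮 ] ∑[ T ← 𝒯 ] ∑[ i′ ← allFin M ] ∑[ j′ ← allFin N ] t S T i j i′ j′
        ≡⟨ ∑∑-cong (allFin M) (allFin N) (λ i j → ∑∑-swap 𝒮 𝒯 (allFin M) (allFin N) _) ⟩
      ∑[ i ← allFin M ] ∑[ j ← allFin N ] ∑[ i′ ← allFin M ] ∑[ j′ ← allFin N ] ∑[ S ← 𝒮 ] ∑[ T ← 𝒯 ] t S T i j i′ j′
        ≡⟨ ∑∑-cong (allFin M) (allFin N) (λ i j → ∑∑-cong (allFin M) (allFin N) (edge-pair i j)) ⟩
      ∑[ i ← allFin M ] ∑[ j ← allFin N ] ∑[ i′ ← allFin M ] ∑[ j′ ← allFin N ]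
        (co 𝒮 i i′ * co 𝒯 j j′ * (e i j * e i′ j′)) ∎
      where
      open ≡-Reasoning
      t : Subset M → Subset N → Fin M → Fin N → Fin M → Fin N → ℕ
      t S T i j i′ j′ = χ S i * χ T j * e i j * (χ S i′ * χ T j′ * e i′ j′)
      edge-pair : ∀ i j i′ j′ → ∑[ S ← 𝒮 ] ∑[ T ← 𝒯 ] t S T i j i′ j′ ≡ co 𝒮 i i′ * co 𝒯 j j′ * (e i j * e i′ j′)
      edge-pair i j i′ j′ =
        trans (∑∑-cong 𝒮 𝒯 (λ S T → regroup (χ S i) (χ T j) (e i j) (χ S i′) (χ T j′) (e i′ j′)))
              (∑∑-factor 𝒮 𝒯 (λ S → χ S i * χ S i′) (λ T → χ T j * χ T j′) (e i j * e i′ j′))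
        where
        regroup : ∀ s u x s′ u′ x′ → s * u * x * (s′ * u′ * x′) ≡ s * s′ * (u * u′) * (x * x′)
        regroup = solve-∀

  module Biregular {𝒮 : List (Subset M)} {𝒯 : List (Subset N)} {k r₁ r₂ ℓ r₁′ r₂′ c d : ℕ}
                   (D𝒮 : Is2Design 𝒮 k r₁ r₂) (D𝒯 : Is2Design 𝒯 ℓ r₁′ r₂′)
                   (deg-left : ∀ i → ∑ (allFin N) (e i) ≡ c)
                   (deg-right : ∀ j → ∑[ i ← allFin M ] e i j ≡ d) where

    open Is2Design-Properties using (co-bound)

    #E≡Mc : #E ≡ M * c
    #E≡Mc = trans (∑-cong (allFin M) deg-left) (∑-allFin-const M c)

    #E≡Nd : #E ≡ N * d
    #E≡Nd = trans (∑-swap (allFin M) (allFin N) e) (trans (∑-cong (allFin N) deg-right) (∑-allFin-const N d))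

    -- Σ X = r₁ r₁′ |E|, i.e. E[X] = ckℓ/N for uniform k- and ℓ-subsets.
    first-moment : ∑[ S ← 𝒮 ] ∑[ T ← 𝒯 ] X S T ≡ r₁ * r₁′ * #E
    first-moment = begin
      ∑[ S ← 𝒮 ] ∑[ T ← 𝒯 ] X S T
        ≡⟨ first-moment-formula 𝒮 𝒯 ⟩
      ∑[ i ← allFin M ] ∑[ j ← allFin N ] (∑[ S ← 𝒮 ] χ S i * ∑[ T ← 𝒯 ] χ T j * e i j)
        ≡⟨ ∑∑-cong (allFin M) (allFin N) (λ i j →
             cong₂ (λ a b → a * b * e i j) (Is2Design.replication D𝒮 i) (Is2Design.replication D𝒯 j)) ⟩
      ∑[ i ← allFin M ] ∑[ j ← allFin N ] (r₁ * r₁′ * e i j)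
        ≡⟨ ∑∑-*ˡ (allFin M) (allFin N) (r₁ * r₁′) e ⟩
      r₁ * r₁′ * #E ∎
      where open ≡-Reasoning

    -- The part of the second moment coming from pairs of distinct edges.
    K : ℕ
    K = r₂ * (M * (r₂′ * c) + r₁′ * d) + r₁ * (r₂′ * c)

    second-edge-sum : ∀ i j
      → ∑[ i′ ← allFin M ] ∑[ j′ ← allFin N ] ((r₂ + δ i i′ * r₁) * (r₂′ + δ j j′ * r₁′) * (e i j * e i′ j′))
      ≡ e i j * (K + r₁ * r₁′ * e i j)
    second-edge-sum i j = begin
      ∑[ i′ ← allFin M ] ∑[ j′ ← allFin N ] (p i′ * q j′ * (e i j * e i′ j′))
        ≡⟨ ∑∑-cong (allFin M) (allFin N) (λ i′ j′ → regroup (p i′) (q j′) (e i j) (e i′ j′)) ⟩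
      ∑[ i′ ← allFin M ] ∑[ j′ ← allFin N ] (e i j * (p i′ * (q j′ * e i′ j′)))
        ≡⟨ ∑-cong (allFin M) (λ i′ → trans (∑-*ˡ (allFin N) (e i j) _) (cong (e i j *_) (∑-*ˡ (allFin N) (p i′) _))) ⟩
      ∑[ i′ ← allFin M ] (e i j * (p i′ * ∑[ j′ ← allFin N ] (q j′ * e i′ j′)))
        ≡⟨ ∑-*ˡ (allFin M) (e i j) _ ⟩
      e i j * ∑[ i′ ← allFin M ] (p i′ * ∑[ j′ ← allFin N ] (q j′ * e i′ j′))
        ≡⟨ cong (e i j *_) (∑-cong (allFin M) (λ i′ → cong (p i′ *_) (row i′))) ⟩
      e i j * ∑[ i′ ← allFin M ] (p i′ * (r₂′ * c + r₁′ * e i′ j))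
        ≡⟨ cong (e i j *_) (∑-δ-affine M i r₂ r₁ (λ i′ → r₂′ * c + r₁′ * e i′ j)) ⟩
      e i j * (r₂ * ∑[ i′ ← allFin M ] (r₂′ * c + r₁′ * e i′ j) + r₁ * (r₂′ * c + r₁′ * e i j))
        ≡⟨ cong (λ z → e i j * (r₂ * z + r₁ * (r₂′ * c + r₁′ * e i j))) column ⟩
      e i j * (r₂ * (M * (r₂′ * c) + r₁′ * d) + r₁ * (r₂′ * c + r₁′ * e i j))
        ≡⟨ cong (e i j *_) (collect r₂ (M * (r₂′ * c) + r₁′ * d) r₁ (r₂′ * c) r₁′ (e i j)) ⟩
      e i j * (K + r₁ * r₁′ * e i j) ∎
      where
      open ≡-Reasoning
      p : Fin M → ℕ
      p i′ = r₂ + δ i i′ * r₁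
      q : Fin N → ℕ
      q j′ = r₂′ + δ j j′ * r₁′
      row : ∀ i′ → ∑[ j′ ← allFin N ] (q j′ * e i′ j′) ≡ r₂′ * c + r₁′ * e i′ j
      row i′ = trans (∑-δ-affine N j r₂′ r₁′ (e i′)) (cong (λ z → r₂′ * z + r₁′ * e i′ j) (deg-left i′))
      column : ∑[ i′ ← allFin M ] (r₂′ * c + r₁′ * e i′ j) ≡ M * (r₂′ * c) + r₁′ * d
      column = trans (∑-+ (allFin M) _ _)
        (cong₂ _+_ (∑-allFin-const M (r₂′ * c)) (trans (∑-*ˡ (allFin M) r₁′ (λ i′ → e i′ j)) (cong (r₁′ *_) (deg-right j))))
      regroup : ∀ p q x y → p * q * (x * y) ≡ x * (p * (q * y))
      regroup = solve-∀
      collect : ∀ a b r u r′ x → a * b + r * (u + r′ * x) ≡ a * b + r * u + r * r′ * x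
      collect = solve-∀

    second-moment : ∑[ S ← 𝒮 ] ∑[ T ← 𝒯 ] (X S T * X S T) ≤ K * #E + r₁ * r₁′ * #E
    second-moment = begin
      ∑[ S ← 𝒮 ] ∑[ T ← 𝒯 ] (X S T * X S T)
        ≡⟨ second-moment-formula 𝒮 𝒯 ⟩
      ∑[ i ← allFin M ] ∑[ j ← allFin N ] ∑[ i′ ← allFin M ] ∑[ j′ ← allFin N ]
        (co 𝒮 i i′ * co 𝒯 j j′ * (e i j * e i′ j′))
        ≤⟨ ∑∑-mono (allFin M) (allFin N) (λ i j → ∑∑-mono (allFin M) (allFin N) (λ i′ j′ →
             *-monoˡ-≤ (e i j * e i′ j′) (*-mono-≤ (co-bound D𝒮 i i′) (co-bound D𝒯 j j′)))) ⟩
      ∑[ i ← allFin M ] ∑[ j ← allFin N ] ∑[ i′ ← allFin M ] ∑[ j′ ← allFin N ]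
        ((r₂ + δ i i′ * r₁) * (r₂′ + δ j j′ * r₁′) * (e i j * e i′ j′))
        ≡⟨ ∑∑-cong (allFin M) (allFin N) second-edge-sum ⟩
      ∑[ i ← allFin M ] ∑[ j ← allFin N ] (e i j * (K + r₁ * r₁′ * e i j))
        ≡⟨ ∑∑-cong (allFin M) (allFin N) (λ i j → expand (r₁ * r₁′) (E i j)) ⟩
      ∑[ i ← allFin M ] ∑[ j ← allFin N ] (K * e i j + r₁ * r₁′ * e i j)
        ≡⟨ ∑∑-+ (allFin M) (allFin N) _ _ ⟩
      ∑[ i ← allFin M ] ∑[ j ← allFin N ] (K * e i j) + ∑[ i ← allFin M ] ∑[ j ← allFin N ] (r₁ * r₁′ * e i j)
        ≡⟨ cong₂ _+_ (∑∑-*ˡ (allFin M) (allFin N) K e) (∑∑-*ˡ (allFin M) (allFin N) (r₁ * r₁′) e) ⟩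
      K * #E + r₁ * r₁′ * #E ∎
      where
      open ≤-Reasoning
      expand : ∀ m b → ⟦ b ⟧ * (K + m * ⟦ b ⟧) ≡ K * ⟦ b ⟧ + m * ⟦ b ⟧
      expand m b = trans (distrib K m ⟦ b ⟧) (cong (λ z → K * ⟦ b ⟧ + m * z) (⟦⟧-idem b))
        where
        distrib : ∀ K m y → y * (K + m * y) ≡ K * y + m * (y * y)
        distrib = solve-∀

    #good : ℕ
    #good = ∑[ S ← 𝒮 ] ∑[ T ← 𝒯 ] ⟦ inducedHasEdge E S T ⟧

    moment-inequality : 2 * (r₁ * r₁′ * #E) ≤ 2 * #good + K * #E
    moment-inequality = +-cancelʳ-≤ μ (2 * μ) (2 * #good + K * #E) (begin
      2 * μ + μ                                     ≡⟨ +-comm (2 * μ) μ ⟩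
      3 * μ                                         ≡⟨ cong (3 *_) first-moment ⟨
      3 * ∑[ S ← 𝒮 ] ∑[ T ← 𝒯 ] X S T               ≡⟨ ∑∑-*ˡ 𝒮 𝒯 3 X ⟨
      ∑[ S ← 𝒮 ] ∑[ T ← 𝒯 ] (3 * X S T)             ≤⟨ ∑∑-mono 𝒮 𝒯 bonferroni ⟩
      ∑[ S ← 𝒮 ] ∑[ T ← 𝒯 ] (2 * ⟦ inducedHasEdge E S T ⟧ + X S T * X S T)
        ≡⟨ ∑∑-+ 𝒮 𝒯 _ _ ⟩
      ∑[ S ← 𝒮 ] ∑[ T ← 𝒯 ] (2 * ⟦ inducedHasEdge E S T ⟧) + ∑[ S ← 𝒮 ] ∑[ T ← 𝒯 ] (X S T * X S T)
        ≤⟨ +-mono-≤ (≤-reflexive (∑∑-*ˡ 𝒮 𝒯 2 _)) second-moment ⟩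
      2 * #good + (K * #E + μ)                      ≡⟨ +-assoc (2 * #good) (K * #E) μ ⟨
      2 * #good + K * #E + μ                        ∎)
      where
      open ≤-Reasoning
      μ : ℕ
      μ = r₁ * r₁′ * #E

    counting-bound : c * k * ℓ * N * (length 𝒮 * length 𝒯)
      ≤ #good * (N * N) + (c * k * ℓ * (c * c * k * k) + c * k * ℓ * (c * k * ℓ)) * (length 𝒮 * length 𝒯)
    counting-bound = *-cancelˡ-≤ 2 (begin
      2 * (a * N * Q)                               ≡⟨ cong (2 *_) mean-scaled ⟨
      2 * (r₁ * r₁′ * (M * c) * (N * N))            ≡⟨ cong (λ z → 2 * (r₁ * r₁′ * z * (N * N))) #E≡Mc ⟨
      2 * (r₁ * r₁′ * #E * (N * N))                 ≡⟨ *-assoc 2 (r₁ * r₁′ * #E) (N * N) ⟨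
      2 * (r₁ * r₁′ * #E) * (N * N)                 ≤⟨ *-monoˡ-≤ (N * N) moment-inequality ⟩
      (2 * #good + K * #E) * (N * N)                ≡⟨ *-distribʳ-+ (N * N) (2 * #good) (K * #E) ⟩
      2 * #good * (N * N) + K * #E * (N * N)        ≡⟨ cong (λ z → 2 * #good * (N * N) + K * z * (N * N)) #E≡Mc ⟩
      2 * #good * (N * N) + K * (M * c) * (N * N)   ≤⟨ +-monoʳ-≤ (2 * #good * (N * N)) correction-bound ⟩
      2 * #good * (N * N) + 2 * (R * Q)             ≡⟨ factor 2 #good (N * N) (R * Q) ⟩
      2 * (#good * (N * N) + R * Q)                 ∎)
      where
      open Is2Design-Properties using (replication-identity; index-bound)
      open ParameterBounds {M} {N} {c} {d} {k} {ℓ} {length 𝒮} {length 𝒯} {r₁} {r₂} {r₁′} {r₂′}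
                           (replication-identity D𝒮) (replication-identity D𝒯)
                           (index-bound D𝒮) (index-bound D𝒯) (trans (sym #E≡Mc) #E≡Nd)
      open ≤-Reasoning
      R : ℕ
      R = a * (c * c * k * k) + a * a
      factor : ∀ m g n z → m * g * n + m * z ≡ m * (g * n + z)
      factor = solve-∀

-- The integer embedding is opened only from here on: its prefix +_ would make
-- the sections (m +_) of natural-number addition used above ambiguous.
open import Data.Integer as ℤ using (+_; +≤+)
open import Data.Integer.Properties using (pos-*; pos-+)
import Data.Integer.Properties as ℤ
import Data.Integer.Tactic.RingSolver as ℤ-Solver
open import Data.Rational using (ℚ; 1ℚ; _/_; _-_; toℚᵘ) renaming (_*_ to _*ℚ_; _≤_ to _≤ℚ_)
open import Data.Rational.Properties using (toℚᵘ-cancel-≤; toℚᵘ-fromℚᵘ; toℚᵘ-homo-*; toℚᵘ-homo-+; toℚᵘ-homo‿-)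
open import Data.Rational.Unnormalised as ℚᵘ using (mkℚᵘ; *≤*)
import Data.Rational.Unnormalised.Properties as ℚᵘ

toℚᵘ-homo-- : ∀ p q → toℚᵘ (p - q) ℚᵘ.≃ toℚᵘ p ℚᵘ.- toℚᵘ q
toℚᵘ-homo-- p q = ℚᵘ.≃-trans (toℚᵘ-homo-+ p (Data.Rational.- q)) (ℚᵘ.+-congʳ (toℚᵘ p) (toℚᵘ-homo‿- q))

cast-Rq : ∀ a b q → + ((a * b + a * a) * q) ≡ (+ a ℤ.* + b ℤ.+ + a ℤ.* + a) ℤ.* + q
cast-Rq a b q = trans (pos-* (a * b + a * a) q)
  (cong (ℤ._* + q) (trans (pos-+ (a * b) (a * a)) (cong₂ ℤ._+_ (pos-* a b) (pos-* a a))))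

cast-correction : ∀ a b q n → + ((a * b + a * a) * q * n) ≡ (+ a ℤ.* + b ℤ.+ + a ℤ.* + a) ℤ.* + q ℤ.* + n
cast-correction a b q n = trans (pos-* ((a * b + a * a) * q) n) (cong (ℤ._* + n) (cast-Rq a b q))

-- The cross products of the unnormalised fractions (a/n)(1 - b/n - a/n) and
-- G/q, exactly as computed by ℚᵘ, in terms of casts of natural numbers.
cross-lhs : ∀ a b n q
  → (+ a ℤ.* ((+ 1 ℤ.* + n ℤ.+ ℤ.- (+ b) ℤ.* + 1) ℤ.* + n ℤ.+ ℤ.- (+ a) ℤ.* + (1 * n))) ℤ.* + q
  ≡ + (a * n * q * n) ℤ.- + ((a * b + a * a) * q * n)
cross-lhs a b n q = begin
  (+ a ℤ.* ((+ 1 ℤ.* + n ℤ.+ ℤ.- (+ b) ℤ.* + 1) ℤ.* + n ℤ.+ ℤ.- (+ a) ℤ.* + (1 * n))) ℤ.* + q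
    ≡⟨ cong (λ m → (+ a ℤ.* ((+ 1 ℤ.* + n ℤ.+ ℤ.- (+ b) ℤ.* + 1) ℤ.* + n ℤ.+ ℤ.- (+ a) ℤ.* + m)) ℤ.* + q)
            (*-identityˡ n) ⟩
  (+ a ℤ.* ((+ 1 ℤ.* + n ℤ.+ ℤ.- (+ b) ℤ.* + 1) ℤ.* + n ℤ.+ ℤ.- (+ a) ℤ.* + n)) ℤ.* + q
    ≡⟨ expand (+ a) (+ b) (+ n) (+ q) ⟩
  + a ℤ.* + n ℤ.* + q ℤ.* + n ℤ.- (+ a ℤ.* + b ℤ.+ + a ℤ.* + a) ℤ.* + q ℤ.* + n
    ≡⟨ cong₂ (λ x y → x ℤ.- y) cast-anqn (cast-correction a b q n) ⟨
  + (a * n * q * n) ℤ.- + ((a * b + a * a) * q * n) ∎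
  where
  open ≡-Reasoning
  expand : ∀ a b n q → (a ℤ.* ((ℤ.1ℤ ℤ.* n ℤ.+ ℤ.- b ℤ.* ℤ.1ℤ) ℤ.* n ℤ.+ ℤ.- a ℤ.* n)) ℤ.* q
                     ≡ a ℤ.* n ℤ.* q ℤ.* n ℤ.- (a ℤ.* b ℤ.+ a ℤ.* a) ℤ.* q ℤ.* n
  expand = ℤ-Solver.solve-∀
  cast-anqn : + (a * n * q * n) ≡ + a ℤ.* + n ℤ.* + q ℤ.* + n
  cast-anqn = trans (pos-* (a * n * q) n) (cong (ℤ._* + n) (trans (pos-* (a * n) q) (cong (ℤ._* + q) (pos-* a n))))

cross-rhs : ∀ a b G n q
  → + ((G * (n * n) + (a * b + a * a) * q) * n) ℤ.- + ((a * b + a * a) * q * n) ≡ + G ℤ.* + (n * ((1 * n) * n))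
cross-rhs a b G n q = begin
  + ((G * (n * n) + (a * b + a * a) * q) * n) ℤ.- + ((a * b + a * a) * q * n)
    ≡⟨ cong₂ (λ x y → x ℤ.- y) cast-sum (cast-correction a b q n) ⟩
  (+ G ℤ.* (+ n ℤ.* + n) ℤ.+ Z) ℤ.* + n ℤ.- Z ℤ.* + n
    ≡⟨ cancel (+ G) (+ n) Z ⟩
  + G ℤ.* (+ n ℤ.* (+ n ℤ.* + n))
    ≡⟨ cong (+ G ℤ.*_) cast-n³ ⟨
  + G ℤ.* + (n * ((1 * n) * n)) ∎
  where
  open ≡-Reasoning
  Z : ℤ.ℤ
  Z = (+ a ℤ.* + b ℤ.+ + a ℤ.* + a) ℤ.* + q
  cancel : ∀ G n z → (G ℤ.* (n ℤ.* n) ℤ.+ z) ℤ.* n ℤ.- z ℤ.* n ≡ G ℤ.* (n ℤ.* (n ℤ.* n))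
  cancel = ℤ-Solver.solve-∀
  cast-n³ : + (n * ((1 * n) * n)) ≡ + n ℤ.* (+ n ℤ.* + n)
  cast-n³ = trans (cong (λ m → + (n * (m * n))) (*-identityˡ n)) (trans (pos-* n (n * n)) (cong (+ n ℤ.*_) (pos-* n n)))
  cast-sum : + ((G * (n * n) + (a * b + a * a) * q) * n) ≡ (+ G ℤ.* (+ n ℤ.* + n) ℤ.+ Z) ℤ.* + n
  cast-sum = trans (pos-* (G * (n * n) + (a * b + a * a) * q) n) (cong (ℤ._* + n)
    (trans (pos-+ (G * (n * n)) ((a * b + a * a) * q))
      (cong₂ ℤ._+_ (trans (pos-* G (n * n)) (cong (+ G ℤ.*_) (pos-* n n))) (cast-Rq a b q))))

cleared : ∀ a b G n q → a * n * q ≤ G * (n * n) + (a * b + a * a) * q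
  → (+ a ℤ.* ((+ 1 ℤ.* + n ℤ.+ ℤ.- (+ b) ℤ.* + 1) ℤ.* + n ℤ.+ ℤ.- (+ a) ℤ.* + (1 * n))) ℤ.* + q
    ℤ.≤ + G ℤ.* + (n * ((1 * n) * n))
cleared a b G n q h = subst₂ ℤ._≤_ (sym (cross-lhs a b n q)) (cross-rhs a b G n q)
  (ℤ.+-monoˡ-≤ (ℤ.- (+ ((a * b + a * a) * q * n))) (+≤+ (*-monoˡ-≤ n h)))

ratio-bound : ∀ a b G n q .{{_ : NonZero n}} .{{_ : NonZero q}}
  → a * n * q ≤ G * (n * n) + (a * b + a * a) * q
  → ((+ a) / n) *ℚ (1ℚ - (+ b) / n - (+ a) / n) ≤ℚ (+ G) / q
ratio-bound a b G n@(suc n′) q@(suc q′) h = toℚᵘ-cancel-≤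
  (ℚᵘ.≤-respˡ-≃ (ℚᵘ.≃-sym lhs≃) (ℚᵘ.≤-respʳ-≃ (ℚᵘ.≃-sym (frac G q′)) (*≤* (cleared a b G n q h))))
  where
  x y : ℚ
  x = (+ a) / n
  y = (+ b) / n
  frac : ∀ m d → toℚᵘ ((+ m) / suc d) ℚᵘ.≃ mkℚᵘ (+ m) d
  frac m d = toℚᵘ-fromℚᵘ (mkℚᵘ (+ m) d)
  -‿cong₂ : ∀ {p p′ r r′} → p ℚᵘ.≃ p′ → r ℚᵘ.≃ r′ → p ℚᵘ.- r ℚᵘ.≃ p′ ℚᵘ.- r′
  -‿cong₂ p≃p′ r≃r′ = ℚᵘ.+-cong p≃p′ (ℚᵘ.-‿cong r≃r′)
  lhs≃ : toℚᵘ (x *ℚ (1ℚ - y - x)) ℚᵘ.≃ mkℚᵘ (+ a) n′ ℚᵘ.* (ℚᵘ.1ℚᵘ ℚᵘ.- mkℚᵘ (+ b) n′ ℚᵘ.- mkℚᵘ (+ a) n′)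
  lhs≃ = ℚᵘ.≃-trans (toℚᵘ-homo-* x (1ℚ - y - x)) (ℚᵘ.*-cong (frac a n′)
    (ℚᵘ.≃-trans (toℚᵘ-homo-- (1ℚ - y) x)
      (-‿cong₂ (ℚᵘ.≃-trans (toℚᵘ-homo-- 1ℚ y) (-‿cong₂ ℚᵘ.≃-refl (frac b n′))) (frac a n′))))

ratio-≥ : ∀ {p : ℚ} G Q .{{_ : NonZero Q}} → p ≤ℚ (+ G) / Q → p ≤ℚ ratio G Q
ratio-≥ G (suc t) p≤G/Q = p≤G/Q

lemma29 : (M N c d k ℓ : ℕ) → .{{_ : NonZero N}} → (E : BipGraph M N)
        → (∀ i → ∣ leftNbhd E i ∣ ≡ c) → (∀ j → ∣ rightNbhd E j ∣ ≡ d)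
        → k ≤ M → ℓ ≤ N
        → ((+ (c * k * ℓ)) / N) *ℚ (1ℚ - (+ (c * c * k * k)) / N - (+ (c * k * ℓ)) / N) ≤ℚ probEdge E k ℓ
lemma29 M N c d k ℓ E deg-left deg-right k≤M ℓ≤N =
  ratio-≥ #good-pairs #pairs
    (ratio-bound (c * k * ℓ) (c * c * k * k) #good-pairs N #pairs
      (subst₂ (λ G Q → c * k * ℓ * N * Q ≤ G * (N * N) + (c * k * ℓ * (c * c * k * k) + c * k * ℓ * (c * k * ℓ)) * Q)
              (sym #good-pairs≡) (sym (length-cartesianProduct 𝒮 𝒯)) counting-bound))
  where
  𝒮 : List (Subset M)
  𝒮 = subsetsOfSize M k
  𝒯 : List (Subset N)
  𝒯 = subsetsOfSize N ℓ
  open InducedEdges E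
  open Biregular (subsetsOfSize-design M k) (subsetsOfSize-design N ℓ)
                 (λ i → trans (sym (∣tabulate∣ (E i))) (deg-left i))
                 (λ j → trans (sym (∣tabulate∣ (λ i → E i j))) (deg-right j))
  pairs : List (Subset M × Subset N)
  pairs = cartesianProduct 𝒮 𝒯
  #pairs #good-pairs : ℕ
  #pairs = length pairs
  #good-pairs = length (filterᵇ (λ { (S , T) → inducedHasEdge E S T }) pairs)
  #good-pairs≡ : #good-pairs ≡ #good
  #good-pairs≡ = trans (length-filterᵇ _ pairs) (∑-cartesianProduct 𝒮 𝒯 _)
  #pairs≥1 : 1 ≤ #pairs
  #pairs≥1 = subst (1 ≤_) (sym (trans (length-cartesianProduct 𝒮 𝒯) (cong₂ _*_ (#subsetsOfSize M k) (#subsetsOfSize N ℓ))))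
                   (*-mono-≤ (C-pos k≤M) (C-pos ℓ≤N))
  instance
    #pairs≢0 : NonZero #pairs
    #pairs≢0 = >-nonZero #pairs≥1
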